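{- Let $X$ be a robust $X$-set parameter and let $G$ and $G'$ be graphs such that $\mathfrak{X}(G)\cong\mathfrak{X}(G')$. If $X(K_1)=0$ or $G$ and $G'$ have no isolated vertices, then there is a relabeling of the vertices of $G'$ such that $G$ and $G'$ have exactly the same $X$-sets; that is, there is a bijection $\psi:V(G)\to V(G')$ such that for every $S\subseteq V(G)$, $S$ is an $X$-set of $G$ if and only if $\psi(S)$ is an $X$-set of $G'$.
   Context: All graphs are finite, simple, undirected, with nonempty vertex set. A vertex set property assigns to each graph $G$ a family of subsets of $V(G)$ (the $X$-sets of $G$), invariant under graph isomorphism; it is cohesive if every graph has at least one $X$-set. A robust $X$-set parameter is a cohesive vertex set property satisfying: (Superset) if $S$ is an $X$-set of $G$ and $S\subseteq S'\subseteq V(G)$ then $S'$ is an $X$-set; ($(n-1)$-set) if $G$ is connected of order $n\ge 2$, every set of $n-1$ vertices of $G$ is an $X$-set; (Component consistency) if $G_1,\dots,G_k$ are the connected components of $G$, then $S$ is an $X$-set of $G$ iff $S\cap V(G_i)$ is an $X$-set of $G_i$ for every $i$. $X(G)$ is the minimum cardinality of an $X$-set of $G$ and $X(K_1)$ its value on the one-vertex graph. The $X$-TAR graph $\mathfrak{X}(G)$ has as vertices the $X$-sets of $G$, with $S_1,S_2$ adjacent iff $|S_1\ominus S_2|=1$. -}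

module Defs where

open import Data.Nat using (ℕ; zero; suc; _≤_; _∸_)
open import Data.Bool using (Bool; true; false)
open import Data.Fin using (Fin; zero; suc)
open import Data.Fin.Subset using (Subset; _⊆_; _∪_; _─_; ∣_∣) renaming (⊥ to ∅)
open import Data.Vec using (tabulate; lookup)
open import Data.Product using (Σ; _×_; _,_)
open import Data.Sum using (_⊎_)
open import Data.Empty using (⊥)
open import Function.Bundles using (_⇔_; _↔_; Inverse)
open import Function.Definitions using (Injective)
open import Relation.Binary.PropositionalEquality using (_≡_)

record Graph (n : ℕ) : Set where
  field
    adj    : Fin n → Fin n → Bool
    adj-sym : ∀ i j → adj i j ≡ adj j i
    adj-irr : ∀ i → adj i i ≡ false
open Graph public

K₁ : Graph 1
K₁ = record { adj = λ _ _ → false ; adj-sym = λ _ _ → _≡_.refl ; adj-irr = λ _ → _≡_.refl }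

data Reach {n : ℕ} (G : Graph n) : Fin n → Fin n → Set where
  here : ∀ {u} → Reach G u u
  step : ∀ {u v w} → adj G u v ≡ true → Reach G v w → Reach G u w

Connected : ∀ {n} → Graph n → Set
Connected {n} G = ∀ (u v : Fin n) → Reach G u v

Isolated : ∀ {n} → Graph n → Fin n → Set
Isolated {n} G v = ∀ (u : Fin n) → adj G v u ≡ false

NoIsolated : ∀ {n} → Graph n → Set
NoIsolated {n} G = ∀ (v : Fin n) → Isolated G v → ⊥

record GraphIso {n m : ℕ} (G : Graph n) (H : Graph m) : Set where
  field
    bij      : Fin n ↔ Fin m
    preserve : ∀ i j → adj H (Inverse.to bij i) (Inverse.to bij j) ≡ adj G i j

image : ∀ {n m} → Fin n ↔ Fin m → Subset n → Subset m
image ψ S = tabulate (λ j → lookup S (Inverse.from ψ j))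

preimage : ∀ {k n} → (Fin k → Fin n) → Subset n → Subset k
preimage e S = tabulate (λ i → lookup S (e i))

-- induced subgraph on an enumeration e : Fin k → Fin n (injective in use)
induced : ∀ {k n} → Graph n → (Fin k → Fin n) → Graph k
induced G e = record
  { adj = λ i j → adj G (e i) (e j)
  ; adj-sym = λ i j → adj-sym G (e i) (e j)
  ; adj-irr = λ i → adj-irr G (e i) }

-- e : Fin (suc k) → Fin n is an injective enumeration of (the vertex set of)
-- a connected component of G: its image is exactly the set of vertices
-- reachable from e zero.
IsComponent : ∀ {k n} → Graph n → (Fin (suc k) → Fin n) → Set
IsComponent {k} {n} G e =
  Injective _≡_ _≡_ e × (∀ (v : Fin n) → (Σ (Fin (suc k)) (λ i → e i ≡ v)) ⇔ Reach G (e zero) v)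

_⊖_ : ∀ {n} → Subset n → Subset n → Subset n
S ⊖ T = (S ─ T) ∪ (T ─ S)

-- Vertex set properties (graphs have nonempty vertex sets: Fin (suc n))

VSProp : Set₁
VSProp = ∀ {n : ℕ} → Graph (suc n) → Subset (suc n) → Set

record RobustParam : Set₁ where
  field
    isX : VSProp
    iso-inv : ∀ {n m} {G : Graph (suc n)} {H : Graph (suc m)} (φ : GraphIso G H) (S : Subset (suc n)) →
              isX G S ⇔ isX H (image (GraphIso.bij φ) S)
    cohesive : ∀ {n} (G : Graph (suc n)) → Σ (Subset (suc n)) (λ S → isX G S)
    superset : ∀ {n} (G : Graph (suc n)) (S S' : Subset (suc n)) → S ⊆ S' → isX G S → isX G S'
    n-1-set : ∀ {n} (G : Graph (suc n)) → 1 ≤ n → Connected G →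
              ∀ (S : Subset (suc n)) → ∣ S ∣ ≡ n → isX G S
    comp-cons : ∀ {n} (G : Graph (suc n)) (S : Subset (suc n)) →
                isX G S ⇔ (∀ (k : ℕ) (e : Fin (suc k) → Fin (suc n)) → IsComponent G e →
                           isX (induced G e) (preimage e S))
open RobustParam public

XNumber : (X : RobustParam) → ∀ {n} → Graph (suc n) → ℕ → Set
XNumber X {n} G k =
  Σ (Subset (suc n)) (λ S → isX X G S × ∣ S ∣ ≡ k) × (∀ (S : Subset (suc n)) → isX X G S → k ≤ ∣ S ∣)

-- 𝔛(G) ≅ 𝔛(G'): a bijection between the families of X-sets (the vertices
-- of the TAR graphs) preserving adjacency |S₁ ⊖ S₂| = 1 in both directions.
record TARIso (X : RobustParam) {n m : ℕ} (G : Graph (suc n)) (H : Graph (suc m)) : Set where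
  field
    f     : Subset (suc n) → Subset (suc m)
    g     : Subset (suc m) → Subset (suc n)
    f-X   : ∀ S → isX X G S → isX X H (f S)
    g-X   : ∀ T → isX X H T → isX X G (g T)
    gf    : ∀ S → isX X G S → g (f S) ≡ S
    fg    : ∀ T → isX X H T → f (g T) ≡ T
    f-adj : ∀ S₁ S₂ → isX X G S₁ → isX X G S₂ →
            (∣ S₁ ⊖ S₂ ∣ ≡ 1) ⇔ (∣ f S₁ ⊖ f S₂ ∣ ≡ 1)

-- The X-sets of a graph form an up-closed family of subsets of V(G), and in an
-- up-closed family any two members are joined by a path of length equal to
-- their Hamming distance. Hence TAR-distance is Hamming distance, and an
-- isomorphism f : 𝔛(G) ≅ 𝔛(G') is an isometry. Under the hypothesis, V and
-- all V − v are X-sets; f(V − v) is adjacent to f(V), so it differs from it in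
-- a single vertex ψ(v), and ψ is a bijection. Comparing distances to V and to
-- V − v shows that f(S) agrees with f(V) at ψ(v) exactly when v ∈ S, i.e.
-- f(S) is ψ(S) symmetrically differenced with the fixed set V' − f(V). Since
-- both families are up-closed, this mask can be absorbed by enlarging sets, so
-- ψ relabels the X-sets of G onto those of G'.
module Submission where

open import Defs
open import Algebra.Properties.CommutativeSemigroup using (interchange)
open import Data.Bool using (Bool; true; false; not; _∨_)
open import Data.Bool.Properties using (not-¬) renaming (_≟_ to _≟ᴮ_)
open import Data.Empty using (⊥-elim)
open import Data.Fin using (Fin; zero; suc; punchOut)
open import Data.Fin.Properties using (any?; injective⇒≤; punchOut-injective) renaming (_≟_ to _≟ᶠ_)
open import Data.Fin.Subset using (Subset; _⊆_; _∪_; ∁; ∣_∣; ⊤) renaming (⊥ to ∅)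
open import Data.Fin.Subset.Properties using (∈⊤; ⊆⊤; ⊆-refl; p⊆p∪q; ∣⊤∣≡n)
open import Data.Nat using (ℕ; zero; suc; _+_; _≤_; z≤n; s≤s)
open import Data.Nat.Properties using (+-suc; +-mono-≤; ≤-antisym; ≤-trans; 1+n≰n; suc-injective; m≢1+n+m; +-commutativeSemigroup; module ≤-Reasoning)
open import Data.Product using (Σ; ∃; _×_; _,_; proj₁; proj₂)
import Data.Product as Product
open import Data.Sum using (_⊎_)
import Data.Sum as Sum
open import Data.Vec using (Vec; []; _∷_; lookup; tabulate; updateAt)
open import Data.Vec.Properties using (∷-injectiveˡ; ∷-injectiveʳ; lookup∘tabulate; tabulate∘lookup; tabulate-cong; lookup-map; lookup-zipWith; lookup∘updateAt; lookup∘updateAt′; []=⇒lookup; lookup⇒[]=)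
open import Function.Bundles using (_⇔_; _↔_; Inverse; Equivalence; mk↔ₛ′; mk⇔)
open import Function.Construct.Identity using (↔-id)
open import Function.Definitions using (Injective)
open import Function.Properties.Equivalence using (⇔-setoid)
open import Level using (0ℓ)
open import Relation.Nullary using (¬_; Dec; yes; no)
open import Relation.Nullary.Decidable using (_×-dec_)
open import Relation.Binary.PropositionalEquality
import Relation.Binary.Reasoning.Setoid as SetoidReasoning

differ : Bool → Bool → ℕ
differ false false = 0
differ true  true  = 0
differ false true  = 1
differ true  false = 1

hamming : ∀ {N} → Vec Bool N → Vec Bool N → ℕ
hamming []       []       = 0
hamming (x ∷ xs) (y ∷ ys) = differ x y + hamming xs ys

∣⊖∣≡hamming : ∀ {N} (S T : Subset N) → ∣ S ⊖ T ∣ ≡ hamming S T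
∣⊖∣≡hamming []           []           = refl
∣⊖∣≡hamming (false ∷ xs) (false ∷ ys) = ∣⊖∣≡hamming xs ys
∣⊖∣≡hamming (true  ∷ xs) (true  ∷ ys) = ∣⊖∣≡hamming xs ys
∣⊖∣≡hamming (false ∷ xs) (true  ∷ ys) = cong suc (∣⊖∣≡hamming xs ys)
∣⊖∣≡hamming (true  ∷ xs) (false ∷ ys) = cong suc (∣⊖∣≡hamming xs ys)

hamming-self : ∀ {N} (x : Vec Bool N) → hamming x x ≡ 0
hamming-self []           = refl
hamming-self (false ∷ xs) = hamming-self xs
hamming-self (true  ∷ xs) = hamming-self xs

hamming≡0⇒≡ : ∀ {N} (x y : Vec Bool N) → hamming x y ≡ 0 → x ≡ y
hamming≡0⇒≡ []           []           _ = refl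
hamming≡0⇒≡ (false ∷ xs) (false ∷ ys) p = cong (false ∷_) (hamming≡0⇒≡ xs ys p)
hamming≡0⇒≡ (true  ∷ xs) (true  ∷ ys) p = cong (true ∷_) (hamming≡0⇒≡ xs ys p)

differ-sym : ∀ a b → differ a b ≡ differ b a
differ-sym false false = refl
differ-sym false true  = refl
differ-sym true  false = refl
differ-sym true  true  = refl

hamming-sym : ∀ {N} (x y : Vec Bool N) → hamming x y ≡ hamming y x
hamming-sym []       []       = refl
hamming-sym (a ∷ xs) (b ∷ ys) = cong₂ _+_ (differ-sym a b) (hamming-sym xs ys)

differ-triangle : ∀ a b c → differ a c ≤ differ a b + differ b c
differ-triangle false false false = z≤n
differ-triangle false false true  = s≤s z≤n
differ-triangle false true  false = z≤n
differ-triangle false true  true  = s≤s z≤n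
differ-triangle true  false false = s≤s z≤n
differ-triangle true  false true  = z≤n
differ-triangle true  true  false = s≤s z≤n
differ-triangle true  true  true  = z≤n

hamming-triangle : ∀ {N} (x y z : Vec Bool N) → hamming x z ≤ hamming x y + hamming y z
hamming-triangle []       []       []       = z≤n
hamming-triangle (a ∷ xs) (b ∷ ys) (c ∷ zs) = begin
  differ a c + hamming xs zs
    ≤⟨ +-mono-≤ (differ-triangle a b c) (hamming-triangle xs ys zs) ⟩
  (differ a b + differ b c) + (hamming xs ys + hamming ys zs)
    ≡⟨ interchange +-commutativeSemigroup (differ a b) (differ b c) (hamming xs ys) (hamming ys zs) ⟩
  (differ a b + hamming xs ys) + (differ b c + hamming ys zs) ∎
  where open ≤-Reasoning

toggle : ∀ {N} → Fin N → Subset N → Subset N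
toggle c S = updateAt S c not

hamming-toggle-agree : ∀ {N} (c : Fin N) (x y : Vec Bool N) → lookup x c ≡ lookup y c →
                       hamming x (toggle c y) ≡ suc (hamming x y)
hamming-toggle-agree zero    (false ∷ xs) (false ∷ ys) _ = refl
hamming-toggle-agree zero    (true  ∷ xs) (true  ∷ ys) _ = refl
hamming-toggle-agree (suc c) (a ∷ xs) (b ∷ ys) e =
  trans (cong (differ a b +_) (hamming-toggle-agree c xs ys e)) (+-suc (differ a b) _)

hamming-toggle-disagree : ∀ {N} (c : Fin N) (x y : Vec Bool N) → lookup x c ≢ lookup y c →
                          suc (hamming x (toggle c y)) ≡ hamming x y
hamming-toggle-disagree zero    (false ∷ xs) (false ∷ ys) ne = ⊥-elim (ne refl)
hamming-toggle-disagree zero    (true  ∷ xs) (true  ∷ ys) ne = ⊥-elim (ne refl)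
hamming-toggle-disagree zero    (false ∷ xs) (true  ∷ ys) _  = refl
hamming-toggle-disagree zero    (true  ∷ xs) (false ∷ ys) _  = refl
hamming-toggle-disagree (suc c) (a ∷ xs) (b ∷ ys) ne =
  trans (sym (+-suc (differ a b) _)) (cong (differ a b +_) (hamming-toggle-disagree c xs ys ne))

hamming-toggle : ∀ {N} (c : Fin N) (x : Vec Bool N) → hamming x (toggle c x) ≡ 1
hamming-toggle c x = trans (hamming-toggle-agree c x x refl) (cong suc (hamming-self x))

agree⇔hamming-toggle : ∀ {N} (c : Fin N) (x y : Vec Bool N) →
                       (lookup x c ≡ lookup y c) ⇔ (hamming x (toggle c y) ≡ suc (hamming x y))
agree⇔hamming-toggle c x y = mk⇔ (hamming-toggle-agree c x y) agree
  where
  agree : hamming x (toggle c y) ≡ suc (hamming x y) → lookup x c ≡ lookup y c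
  agree longer with lookup x c ≟ᴮ lookup y c
  ... | yes e  = e
  ... | no  ne = ⊥-elim (m≢1+n+m (hamming x y) (trans (sym (hamming-toggle-disagree c x y ne)) (cong suc longer)))

hamming≡1⇒toggle : ∀ {N} (x y : Vec Bool N) → hamming x y ≡ 1 → ∃ λ c → x ≡ toggle c y
hamming≡1⇒toggle []           []           ()
hamming≡1⇒toggle (false ∷ xs) (false ∷ ys) p = Product.map suc (cong (false ∷_)) (hamming≡1⇒toggle xs ys p)
hamming≡1⇒toggle (true  ∷ xs) (true  ∷ ys) p = Product.map suc (cong (true ∷_)) (hamming≡1⇒toggle xs ys p)
hamming≡1⇒toggle (false ∷ xs) (true  ∷ ys) p = zero , cong (false ∷_) (hamming≡0⇒≡ xs ys (suc-injective p))
hamming≡1⇒toggle (true  ∷ xs) (false ∷ ys) p = zero , cong (true ∷_) (hamming≡0⇒≡ xs ys (suc-injective p))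

toggle-injective : ∀ {N} {c d : Fin N} (x : Vec Bool N) → toggle c x ≡ toggle d x → c ≡ d
toggle-injective {c = zero}  {zero}  _        _ = refl
toggle-injective {c = zero}  {suc d} (a ∷ xs) e = ⊥-elim (not-¬ refl (sym (∷-injectiveˡ e)))
toggle-injective {c = suc c} {zero}  (a ∷ xs) e = ⊥-elim (not-¬ refl (∷-injectiveˡ e))
toggle-injective {c = suc c} {suc d} (a ∷ xs) e = cong suc (toggle-injective xs (∷-injectiveʳ e))

hamming≡suc⇒disagree : ∀ {N k} (x y : Vec Bool N) → hamming x y ≡ suc k → ∃ λ c → lookup x c ≢ lookup y c
hamming≡suc⇒disagree []           []           ()
hamming≡suc⇒disagree (false ∷ xs) (false ∷ ys) p = Product.map suc (λ ne → ne) (hamming≡suc⇒disagree xs ys p)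
hamming≡suc⇒disagree (true  ∷ xs) (true  ∷ ys) p = Product.map suc (λ ne → ne) (hamming≡suc⇒disagree xs ys p)
hamming≡suc⇒disagree (false ∷ xs) (true  ∷ ys) _ = zero , λ ()
hamming≡suc⇒disagree (true  ∷ xs) (false ∷ ys) _ = zero , λ ()

⊆-toggle : ∀ {N} {R S : Subset N} {c : Fin N} → R ⊆ S → lookup R c ≡ false → R ⊆ toggle c S
⊆-toggle {S = S} {c} R⊆S Rc≡false {x} x∈R with x ≟ᶠ c
... | yes refl = ⊥-elim (not-¬ Rc≡false ([]=⇒lookup x∈R))
... | no  x≢c  = lookup⇒[]= x _ (trans (lookup∘updateAt′ x c x≢c S) ([]=⇒lookup (R⊆S x∈R)))

UpClosed : ∀ {N} → (Subset N → Set) → Set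
UpClosed {N} P = ∀ {S S' : Subset N} → S ⊆ S' → P S → P S'

module _ {N} {P : Subset N → Set} (up : UpClosed P) where

  -- Add a vertex of T − S to S if there is one; otherwise T ⊆ S and removing a
  -- vertex of S − T keeps a superset of T.
  geodesic-step : ∀ {k S T} → P S → P T → hamming S T ≡ suc k →
                  ∃ λ S' → P S' × hamming S S' ≡ 1 × hamming S' T ≡ k
  geodesic-step {k} {S} {T} pS pT d =
    choose (any? (λ c → (lookup S c ≟ᴮ false) ×-dec (lookup T c ≟ᴮ true)))
    where
    Result : Set
    Result = ∃ λ S' → P S' × hamming S S' ≡ 1 × hamming S' T ≡ k

    toward : ∀ c → P (toggle c S) → lookup S c ≢ lookup T c → Result
    toward c p Sc≢Tc = toggle c S , p , hamming-toggle c S , suc-injective (begin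
      suc (hamming (toggle c S) T) ≡⟨ cong suc (hamming-sym (toggle c S) T) ⟩
      suc (hamming T (toggle c S)) ≡⟨ hamming-toggle-disagree c T S (λ e → Sc≢Tc (sym e)) ⟩
      hamming T S                  ≡⟨ hamming-sym T S ⟩
      hamming S T                  ≡⟨ d ⟩
      suc k                        ∎)
      where open ≡-Reasoning

    ⊆-of-no-addition : ¬ (∃ λ c → lookup S c ≡ false × lookup T c ≡ true) → T ⊆ S
    ⊆-of-no-addition none {x} x∈T with lookup S x in Sx
    ... | true  = lookup⇒[]= x S Sx
    ... | false = ⊥-elim (none (x , Sx , []=⇒lookup x∈T))

    choose : Dec (∃ λ c → lookup S c ≡ false × lookup T c ≡ true) → Result
    choose (yes (c , Sc≡false , Tc≡true)) =
      toward c (up (⊆-toggle ⊆-refl Sc≡false) pS) (λ e → not-¬ Sc≡false (trans e Tc≡true))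
    choose (no none) with hamming≡suc⇒disagree S T d
    ... | c , Sc≢Tc with lookup T c in Tc
    ... | false = toward c (up (⊆-toggle (⊆-of-no-addition none) Tc) pT) (λ e → Sc≢Tc (trans e Tc))
    ... | true  = ⊥-elim (Sc≢Tc ([]=⇒lookup (⊆-of-no-addition none (lookup⇒[]= c T Tc))))

  nonexpanding : ∀ {M} (f : Subset N → Subset M) →
                 (∀ {S₁ S₂} → P S₁ → P S₂ → hamming S₁ S₂ ≡ 1 → hamming (f S₁) (f S₂) ≡ 1) →
                 ∀ {S T} → P S → P T → hamming (f S) (f T) ≤ hamming S T
  nonexpanding f adjacent pS pT = along _ pS pT refl
    where
    along : ∀ k {S T} → P S → P T → hamming S T ≡ k → hamming (f S) (f T) ≤ k
    along zero {S} {T} _ _ d rewrite hamming≡0⇒≡ S T d | hamming-self (f T) = z≤n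
    along (suc k) {S} {T} pS pT d with geodesic-step pS pT d
    ... | S' , pS' , d₁ , d₂ = begin
      hamming (f S) (f T)                          ≤⟨ hamming-triangle (f S) (f S') (f T) ⟩
      hamming (f S) (f S') + hamming (f S') (f T)  ≡⟨ cong (_+ _) (adjacent pS pS' d₁) ⟩
      suc (hamming (f S') (f T))                   ≤⟨ s≤s (along k pS' pT d₂) ⟩
      suc k                                        ∎
      where open ≤-Reasoning

record AdjacencyIso {N M} (P : Subset N → Set) (Q : Subset M → Set) : Set where
  field
    to            : Subset N → Subset M
    from          : Subset M → Subset N
    to-∈          : ∀ {S} → P S → Q (to S)
    from-∈        : ∀ {T} → Q T → P (from T)
    from∘to       : ∀ {S} → P S → from (to S) ≡ S
    to∘from       : ∀ {T} → Q T → to (from T) ≡ T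
    to-adjacent   : ∀ {S₁ S₂} → P S₁ → P S₂ → hamming S₁ S₂ ≡ 1 → hamming (to S₁) (to S₂) ≡ 1
    from-adjacent : ∀ {T₁ T₂} → Q T₁ → Q T₂ → hamming T₁ T₂ ≡ 1 → hamming (from T₁) (from T₂) ≡ 1

  inverse : AdjacencyIso Q P
  inverse = record
    { to = from ; from = to ; to-∈ = from-∈ ; from-∈ = to-∈ ; from∘to = to∘from ; to∘from = from∘to
    ; to-adjacent = from-adjacent ; from-adjacent = to-adjacent }

hamming-to : ∀ {N M} {P : Subset N → Set} {Q : Subset M → Set} → UpClosed P → UpClosed Q →
             (φ : AdjacencyIso P Q) → ∀ {S T} → P S → P T →
             hamming (AdjacencyIso.to φ S) (AdjacencyIso.to φ T) ≡ hamming S T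
hamming-to upP upQ φ pS pT = ≤-antisym (nonexpanding upP to to-adjacent pS pT)
  (subst₂ (λ S T → hamming S T ≤ _) (from∘to pS) (from∘to pT)
     (nonexpanding upQ from from-adjacent (to-∈ pS) (to-∈ pT)))
  where open AdjacencyIso φ

module Coordinates {N M} {P : Subset N → Set} {Q : Subset M → Set}
  (upP : UpClosed P) (upQ : UpClosed Q) (φ : AdjacencyIso P Q)
  (full : P ⊤) (coatom : ∀ v → P (toggle v ⊤)) where

  open AdjacencyIso φ

  T₀ : Subset M
  T₀ = to ⊤

  coatom-image : ∀ v → ∃ λ c → to (toggle v ⊤) ≡ toggle c T₀
  coatom-image v = hamming≡1⇒toggle _ _ (begin
    hamming (to (toggle v ⊤)) (to ⊤) ≡⟨ hamming-to upP upQ φ (coatom v) full ⟩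
    hamming (toggle v ⊤) ⊤           ≡⟨ hamming-sym (toggle v ⊤) ⊤ ⟩
    hamming ⊤ (toggle v ⊤)           ≡⟨ hamming-toggle v ⊤ ⟩
    1                                ∎)
    where open ≡-Reasoning

  ψ : Fin N → Fin M
  ψ v = proj₁ (coatom-image v)

  to-coatom : ∀ v → to (toggle v ⊤) ≡ toggle (ψ v) T₀
  to-coatom v = proj₂ (coatom-image v)

  ψ-injective : Injective _≡_ _≡_ ψ
  ψ-injective {v} {w} ψv≡ψw = toggle-injective ⊤ (begin
    toggle v ⊤             ≡⟨ from∘to (coatom v) ⟨
    from (to (toggle v ⊤)) ≡⟨ cong from (to-coatom v) ⟩
    from (toggle (ψ v) T₀) ≡⟨ cong (λ c → from (toggle c T₀)) ψv≡ψw ⟩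
    from (toggle (ψ w) T₀) ≡⟨ cong from (to-coatom w) ⟨
    from (to (toggle w ⊤)) ≡⟨ from∘to (coatom w) ⟩
    toggle w ⊤             ∎)
    where open ≡-Reasoning

  -- v ∈ S iff S is one step farther from V − v than from V; transport this
  -- along the isometry `to`.
  ∈⇔agrees-with-T₀ : ∀ {S} → P S → ∀ v → (lookup S v ≡ true) ⇔ (lookup (to S) (ψ v) ≡ lookup T₀ (ψ v))
  ∈⇔agrees-with-T₀ {S} pS v = begin
    lookup S v ≡ true
      ≡⟨ cong (lookup S v ≡_) ([]=⇒lookup (∈⊤ {x = v})) ⟨
    lookup S v ≡ lookup ⊤ v
      ≈⟨ agree⇔hamming-toggle v S ⊤ ⟩
    hamming S (toggle v ⊤) ≡ suc (hamming S ⊤)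
      ≡⟨ cong₂ (λ a b → a ≡ suc b) to-coatom-distance (hamming-to upP upQ φ pS full) ⟨
    hamming (to S) (toggle (ψ v) T₀) ≡ suc (hamming (to S) T₀)
      ≈⟨ agree⇔hamming-toggle (ψ v) (to S) T₀ ⟨
    lookup (to S) (ψ v) ≡ lookup T₀ (ψ v) ∎
    where
    open SetoidReasoning (⇔-setoid 0ℓ)
    to-coatom-distance : hamming (to S) (toggle (ψ v) T₀) ≡ hamming S (toggle v ⊤)
    to-coatom-distance = trans (cong (hamming (to S)) (sym (to-coatom v))) (hamming-to upP upQ φ pS (coatom v))

injective⇒surjective : ∀ {a b} (h : Fin a → Fin b) → Injective _≡_ _≡_ h → b ≤ a → ∀ j → ∃ λ i → h i ≡ j
injective⇒surjective {b = suc _} h h-injective b≤a j with any? (λ i → h i ≟ᶠ j)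
... | yes hit  = hit
... | no  miss = ⊥-elim (1+n≰n (≤-trans b≤a (injective⇒≤ avoid-injective)))
  where
  j≢h : ∀ i → j ≢ h i
  j≢h i e = miss (i , sym e)
  avoid-injective : Injective _≡_ _≡_ (λ i → punchOut (j≢h i))
  avoid-injective {x} {y} e = h-injective (punchOut-injective (j≢h x) (j≢h y) e)

masked-∈ : ∀ {a t b c} → c ≡ a ∨ not t → (c ≡ true ⇔ b ≡ t) → b ≡ true → a ≡ true
masked-∈ {true}          _    _ _      = refl
masked-∈ {false} {true}  refl h b≡true = Equivalence.from h b≡true
masked-∈ {false} {false} refl h b≡true = ⊥-elim (not-¬ (Equivalence.to h refl) b≡true)

masked-≡⇒∈ : ∀ {a t} → a ∨ not t ≡ t → a ≡ true
masked-≡⇒∈ {true}          _  = refl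
masked-≡⇒∈ {false} {true}  ()
masked-≡⇒∈ {false} {false} ()

⊆-by-lookup : ∀ {N} {S T : Subset N} → (∀ i → lookup S i ≡ true → lookup T i ≡ true) → S ⊆ T
⊆-by-lookup h {i} i∈S = lookup⇒[]= i _ (h i ([]=⇒lookup i∈S))

-- `to` acts as S ↦ ψ(S) ⊖ (V' − T₀); enlarging S by the preimage of the mask
-- V' − T₀ (resp. ψ(S) by the mask itself) cancels it from above.
module Relabelling {N M} {P : Subset N → Set} {Q : Subset M → Set}
  (upP : UpClosed P) (upQ : UpClosed Q) (φ : AdjacencyIso P Q)
  (full : P ⊤) (coatomP : ∀ v → P (toggle v ⊤)) (coatomQ : ∀ j → Q (toggle j ⊤)) where

  open AdjacencyIso φ
  open Coordinates upP upQ φ full coatomP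
  private module Back = Coordinates upQ upP inverse (upQ ⊆⊤ (to-∈ full)) coatomQ

  ψ-surjective : ∀ j → ∃ λ v → ψ v ≡ j
  ψ-surjective = injective⇒surjective ψ ψ-injective (injective⇒≤ Back.ψ-injective)

  ψ↔ : Fin N ↔ Fin M
  ψ↔ = mk↔ₛ′ ψ (λ j → proj₁ (ψ-surjective j)) (λ j → proj₂ (ψ-surjective j))
             (λ v → ψ-injective (proj₂ (ψ-surjective (ψ v))))

  lookup-image : ∀ S v → lookup (image ψ↔ S) (ψ v) ≡ lookup S v
  lookup-image S v = trans (lookup∘tabulate _ (ψ v)) (cong (lookup S) (Inverse.inverseʳ ψ↔ refl))

  mask : Subset M
  mask = ∁ T₀

  lookup-mask : ∀ j → lookup mask j ≡ not (lookup T₀ j)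
  lookup-mask j = lookup-map j not T₀

  X⇒image-X : ∀ {S} → P S → Q (image ψ↔ S)
  X⇒image-X {S} pS = upQ (⊆-by-lookup to-S⁺⊆ψS) (to-∈ pS⁺)
    where
    S⁺ = S ∪ preimage ψ mask
    pS⁺ : P S⁺
    pS⁺ = upP (p⊆p∪q _) pS
    lookup-S⁺ : ∀ v → lookup S⁺ v ≡ lookup S v ∨ not (lookup T₀ (ψ v))
    lookup-S⁺ v = trans (lookup-zipWith _∨_ v S _) (cong (lookup S v ∨_) (trans (lookup∘tabulate _ v) (lookup-mask (ψ v))))
    to-S⁺⊆ψS : ∀ j → lookup (to S⁺) j ≡ true → lookup (image ψ↔ S) j ≡ true
    to-S⁺⊆ψS j j∈ with ψ-surjective j
    ... | v , refl = trans (lookup-image S v) (masked-∈ (lookup-S⁺ v) (∈⇔agrees-with-T₀ pS⁺ v) j∈)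

  image-X⇒X : ∀ {S} → Q (image ψ↔ S) → P S
  image-X⇒X {S} qψS = upP (⊆-by-lookup from-U⊆S) (from-∈ qU)
    where
    U = image ψ↔ S ∪ mask
    qU : Q U
    qU = upQ (p⊆p∪q _) qψS
    lookup-U : ∀ v → lookup U (ψ v) ≡ lookup S v ∨ not (lookup T₀ (ψ v))
    lookup-U v = trans (lookup-zipWith _∨_ (ψ v) (image ψ↔ S) _) (cong₂ _∨_ (lookup-image S v) (lookup-mask (ψ v)))
    from-U⊆S : ∀ v → lookup (from U) v ≡ true → lookup S v ≡ true
    from-U⊆S v v∈ = masked-≡⇒∈ (begin
      lookup S v ∨ not (lookup T₀ (ψ v)) ≡⟨ lookup-U v ⟨
      lookup U (ψ v)                     ≡⟨ cong (λ T → lookup T (ψ v)) (to∘from qU) ⟨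
      lookup (to (from U)) (ψ v)         ≡⟨ Equivalence.to (∈⇔agrees-with-T₀ (from-∈ qU) v) v∈ ⟩
      lookup T₀ (ψ v)                    ∎)
      where open ≡-Reasoning

  relabelling : Σ (Fin N ↔ Fin M) (λ ψ → ∀ S → P S ⇔ Q (image ψ S))
  relabelling = ψ↔ , λ S → mk⇔ X⇒image-X image-X⇒X

lookup-toggle-⊤-≡ : ∀ {n} (v : Fin n) → lookup (toggle v ⊤) v ≡ false
lookup-toggle-⊤-≡ v = trans (lookup∘updateAt v ⊤) (cong not ([]=⇒lookup (∈⊤ {x = v})))

lookup-toggle-⊤-≢ : ∀ {n} {v w : Fin n} → w ≢ v → lookup (toggle v ⊤) w ≡ true
lookup-toggle-⊤-≢ {v = v} {w} w≢v = trans (lookup∘updateAt′ w v w≢v ⊤) ([]=⇒lookup (∈⊤ {x = w}))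

∣toggle-⊤∣ : ∀ {k} (i : Fin (suc k)) → ∣ toggle i ⊤ ∣ ≡ k
∣toggle-⊤∣ {k}     zero    = ∣⊤∣≡n k
∣toggle-⊤∣ {suc k} (suc i) = cong suc (∣toggle-⊤∣ i)

preimage-toggle-⊤-outside : ∀ {k n} (e : Fin k → Fin n) {v} → (∀ i → e i ≢ v) → preimage e (toggle v ⊤) ≡ ⊤
preimage-toggle-⊤-outside e outside =
  trans (tabulate-cong (λ i → trans (lookup-toggle-⊤-≢ (outside i)) (sym ([]=⇒lookup (∈⊤ {x = i})))))
        (tabulate∘lookup ⊤)

preimage-toggle-⊤ : ∀ {k n} {e : Fin k → Fin n} {i v} → Injective _≡_ _≡_ e → e i ≡ v →
                    preimage e (toggle v ⊤) ≡ toggle i ⊤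
preimage-toggle-⊤ {e = e} {i} {v} e-injective ei≡v =
  trans (tabulate-cong pointwise) (tabulate∘lookup (toggle i ⊤))
  where
  pointwise : ∀ j → lookup (toggle v ⊤) (e j) ≡ lookup (toggle i ⊤) j
  pointwise j with j ≟ᶠ i
  ... | yes refl = trans (subst (λ w → lookup (toggle w ⊤) (e j) ≡ false) ei≡v (lookup-toggle-⊤-≡ (e j)))
                         (sym (lookup-toggle-⊤-≡ j))
  ... | no  j≢i  = trans (lookup-toggle-⊤-≢ (λ ej≡v → j≢i (e-injective (trans ej≡v (sym ei≡v)))))
                         (sym (lookup-toggle-⊤-≢ j≢i))

module _ {n} {G : Graph n} where

  reach-snoc : ∀ {a b c} → Reach G a b → adj G b c ≡ true → Reach G a c
  reach-snoc here       q = step q here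
  reach-snoc (step p r) q = step p (reach-snoc r q)

  reach-sym : ∀ {a b} → Reach G a b → Reach G b a
  reach-sym here                = here
  reach-sym (step {u} {v} uv r) = reach-snoc (reach-sym r) (trans (adj-sym G v u) uv)

  reach-trans : ∀ {a b c} → Reach G a b → Reach G b c → Reach G a c
  reach-trans here       r' = r'
  reach-trans (step p r) r' = step p (reach-trans r r')

module _ {n k} {G : Graph n} {e : Fin (suc k) → Fin n} (component : IsComponent G e) where

  private
    in-component : ∀ {v} → Reach G (e zero) v → ∃ λ i → e i ≡ v
    in-component {v} = Equivalence.from (proj₂ component v)

    root-reaches : ∀ i → Reach G (e zero) (e i)
    root-reaches i = Equivalence.to (proj₂ component (e i)) (i , refl)

  walk-in-component : ∀ {i t} → Reach G (e i) t → ∃ λ j → e j ≡ t × Reach (induced G e) i j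
  walk-in-component {i} here = i , refl , here
  walk-in-component {i} (step q r) with in-component (reach-snoc (root-reaches i) q)
  ... | i′ , refl with walk-in-component r
  ... | j , ej≡t , r′ = j , ej≡t , step q r′

  component-connected : Connected (induced G e)
  component-connected a b = reach-trans (reach-sym (from-root a)) (from-root b)
    where
    from-root : ∀ b → Reach (induced G e) zero b
    from-root b with walk-in-component (root-reaches b)
    ... | j , ej≡eb , r = subst (Reach (induced G e) zero) (proj₁ component ej≡eb) r

singleton-component-isolated : ∀ {n} {G : Graph n} {e : Fin 1 → Fin n} → IsComponent G e → Isolated G (e zero)
singleton-component-isolated {G = G} {e} component u with adj G (e zero) u in e₀u
... | false = refl
... | true with Equivalence.from (proj₂ component u) (step e₀u here)
... | zero , refl = trans (sym e₀u) (adj-irr G (e zero))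

K₁≅ : (H : Graph 1) → GraphIso K₁ H
K₁≅ H = record { bij = ↔-id (Fin 1) ; preserve = λ { zero zero → adj-irr H zero } }

module _ (X : RobustParam) where

  isX-upClosed : ∀ {n} (G : Graph (suc n)) → UpClosed (isX X G)
  isX-upClosed G = superset X G _ _

  ⊤-isX : ∀ {n} (G : Graph (suc n)) → isX X G ⊤
  ⊤-isX G = isX-upClosed G ⊆⊤ (proj₂ (cohesive X G))

  ∅-isX-K₁ : XNumber X K₁ 0 → isX X K₁ ∅
  ∅-isX-K₁ ((false ∷ [] , ∅-isX , _) , _) = ∅-isX
  ∅-isX-K₁ ((true  ∷ [] , _ , ()) , _)

  -- V − v restricts to the whole of every component missing v and to an
  -- (order − 1)-set of the connected component containing v; only when that
  -- component is a single vertex is the hypothesis needed.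
  coatom-isX : ∀ {n} (G : Graph (suc n)) → XNumber X K₁ 0 ⊎ NoIsolated G → ∀ v → isX X G (toggle v ⊤)
  coatom-isX G hyp v = Equivalence.from (comp-cons X G (toggle v ⊤)) on-component
    where
    within : ∀ k {e} → IsComponent G e → (i : Fin (suc k)) → isX X (induced G e) (toggle i ⊤)
    within (suc k) component i = n-1-set X _ (s≤s z≤n) (component-connected component) _ (∣toggle-⊤∣ i)
    within zero {e} component zero = Sum.[
      (λ X[K₁]≡0 → Equivalence.to (iso-inv X (K₁≅ (induced G e)) ∅) (∅-isX-K₁ X[K₁]≡0)) ,
      (λ no-isolated → ⊥-elim (no-isolated (e zero) (singleton-component-isolated component))) ] hyp

    on-component : ∀ k e → IsComponent G e → isX X (induced G e) (preimage e (toggle v ⊤))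
    on-component k e component with any? (λ i → e i ≟ᶠ v)
    ... | yes (i , ei≡v) =
      subst (isX X _) (sym (preimage-toggle-⊤ (proj₁ component) ei≡v)) (within k component i)
    ... | no outside =
      subst (isX X _) (sym (preimage-toggle-⊤-outside e (λ i ei≡v → outside (i , ei≡v)))) (⊤-isX _)

  TARIso⇒AdjacencyIso : ∀ {n m} {G : Graph (suc n)} {G' : Graph (suc m)} →
                        TARIso X G G' → AdjacencyIso (isX X G) (isX X G')
  TARIso⇒AdjacencyIso φ = record
    { to = f ; from = g ; to-∈ = f-X _ ; from-∈ = g-X _ ; from∘to = gf _ ; to∘from = fg _
    ; to-adjacent = λ {S₁} {S₂} p₁ p₂ d →
        card⇒hamming (f S₁) (f S₂) (Equivalence.to (f-adj S₁ S₂ p₁ p₂) (hamming⇒card S₁ S₂ d))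
    ; from-adjacent = λ {T₁} {T₂} q₁ q₂ d →
        card⇒hamming (g T₁) (g T₂) (Equivalence.from (f-adj _ _ (g-X T₁ q₁) (g-X T₂ q₂))
          (subst₂ (λ A B → ∣ A ⊖ B ∣ ≡ 1) (sym (fg T₁ q₁)) (sym (fg T₂ q₂)) (hamming⇒card T₁ T₂ d)))
    }
    where
    open TARIso φ
    card⇒hamming : ∀ {N} (S T : Subset N) → ∣ S ⊖ T ∣ ≡ 1 → hamming S T ≡ 1
    card⇒hamming S T = subst (_≡ 1) (∣⊖∣≡hamming S T)
    hamming⇒card : ∀ {N} (S T : Subset N) → hamming S T ≡ 1 → ∣ S ⊖ T ∣ ≡ 1
    hamming⇒card S T = subst (_≡ 1) (sym (∣⊖∣≡hamming S T))

theorem2p23 : (X : RobustParam) {n m : ℕ} (G : Graph (suc n)) (G' : Graph (suc m)) →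
    TARIso X G G' →
    (XNumber X K₁ 0 ⊎ (NoIsolated G × NoIsolated G')) →
    Σ (Fin (suc n) ↔ Fin (suc m)) (λ ψ → ∀ (S : Subset (suc n)) → isX X G S ⇔ isX X G' (image ψ S))
theorem2p23 X G G' φ hyp =
  Relabelling.relabelling (isX-upClosed X G) (isX-upClosed X G') (TARIso⇒AdjacencyIso X φ) (⊤-isX X G)
    (coatom-isX X G (Sum.map₂ proj₁ hyp)) (coatom-isX X G' (Sum.map₂ proj₂ hyp))
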